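{- Let $0\le\epsilon\le1$, let $l\le r$ be natural numbers, and set $i=\frac{1+\epsilon/2}{1+\epsilon}l+\frac{\epsilon/2}{1+\epsilon}r$ and $j=\frac{\epsilon/2}{1+\epsilon}l+\frac{1+\epsilon/2}{1+\epsilon}r$. Let $a,b$ be integers with $i\le a<b\le j$. Let $G$ be any graph whose vertices are integers (possibly outside $[l,r]$), with each edge $(x,y)$ weighted $|x-y|$, and let $P$ be a path in $G$ from $a$ to $b$ of weight at most $(1+\epsilon)(b-a)$. Then every vertex of $P$ lies in $[l,r]$.
   Context: The uniform line metric $U(l,r)$ is the set of integers $x$ with $l\le x\le r$ with distance $|x-y|$; a $(1+\epsilon)$-spanner path between $a$ and $b$ is a path of weight at most $(1+\epsilon)|a-b|$.
   Formalization: The parameter ε ranges over the rationals in [0,1]. -}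

module Defs where

open import Data.Nat using (ℕ)
open import Data.Integer as ℤ using (ℤ; +_; ∣_∣)
open import Data.Rational as ℚ using (ℚ; 0ℚ; 1ℚ; ½; _/_; NonZero)
open import Data.Rational.Properties as ℚP using (+-mono-<-≤; positive⁻¹)
open import Data.List using (List; []; _∷_)

⟦_⟧ : ℤ → ℚ
⟦ x ⟧ = x / 1

1+ε-nonZero : (ε : ℚ) → 0ℚ ℚ.≤ ε → NonZero (1ℚ ℚ.+ ε)
1+ε-nonZero ε 0≤ε = ℚ.>-nonZero (+-mono-<-≤ (positive⁻¹ 1ℚ) 0≤ε)

iPt : (ε : ℚ) → 0ℚ ℚ.≤ ε → ℕ → ℕ → ℚ
iPt ε p l r =
  ℚ._÷_ (1ℚ ℚ.+ ε ℚ.* ½) (1ℚ ℚ.+ ε) {{1+ε-nonZero ε p}} ℚ.* ⟦ + l ⟧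
  ℚ.+ ℚ._÷_ (ε ℚ.* ½) (1ℚ ℚ.+ ε) {{1+ε-nonZero ε p}} ℚ.* ⟦ + r ⟧

jPt : (ε : ℚ) → 0ℚ ℚ.≤ ε → ℕ → ℕ → ℚ
jPt ε p l r =
  ℚ._÷_ (ε ℚ.* ½) (1ℚ ℚ.+ ε) {{1+ε-nonZero ε p}} ℚ.* ⟦ + l ⟧
  ℚ.+ ℚ._÷_ (1ℚ ℚ.+ ε ℚ.* ½) (1ℚ ℚ.+ ε) {{1+ε-nonZero ε p}} ℚ.* ⟦ + r ⟧

record Graph : Set₁ where
  field
    Edge : ℤ → ℤ → Set
    sym  : ∀ {x y} → Edge x y → Edge y x
open Graph public

data Path (G : Graph) : ℤ → ℤ → Set where
  []  : ∀ {x} → Path G x x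
  _∷_ : ∀ {x y z} → Edge G x y → Path G y z → Path G x z

weight : ∀ {G x y} → Path G x y → ℕ
weight [] = 0
weight (_∷_ {x} {y} _ p) = ∣ x ℤ.- y ∣ Data.Nat.+ weight p
  where import Data.Nat

vertices : ∀ {G x y} → Path G x y → List ℤ
vertices {x = x} [] = x ∷ []
vertices {x = x} (_ ∷ p) = x ∷ vertices p

{-# OPTIONS --safe #-}
-- A vertex v of a path from a to b satisfies |a − v| + |v − b| ≤ w(P) ≤ (1+ε)(b − a).
-- Hence 2v ≥ (2+ε)a − εb ≥ (2+ε)i − εj = 2l, and symmetrically 2v ≤ (2+ε)b − εa ≤
-- (2+ε)j − εi = 2r; the two identities are where the particular i and j come from.
module Submission where

open import Defs
open import Data.Nat using (ℕ; _≤_)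
open import Data.Integer as ℤ using (ℤ; +_)
open import Data.Rational as ℚ using (ℚ; 0ℚ; 1ℚ)
open import Data.List.Relation.Unary.All using (All)
open import Data.Product using (_×_)

import Data.Nat as ℕ
import Data.Nat.Properties as ℕP
open import Data.Nat.Coprimality using (1-coprimeTo) renaming (sym to coprime-sym)
open import Data.Integer using (-[1+_]; ∣_∣)
import Data.Integer.Properties as ℤP
import Data.Integer.Solver as ℤSolver
open import Data.Rational using (mkℚ; ½; _+_; _*_; _-_; -_)
import Data.Rational.Properties as ℚP
import Data.Rational.Solver as ℚSolver
import Data.Rational.Unnormalised as ℚᵘ
import Data.Rational.Unnormalised.Properties as ℚᵘP
open import Data.List.Relation.Unary.All as All using ([]; _∷_)
open import Data.Product using (_,_)
open import Relation.Binary.PropositionalEquality as ≡ hiding (sym)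

integral : ℤ → ℚ
integral x = mkℚ x 0 (coprime-sym (1-coprimeTo ∣ x ∣))

⟦⟧-canonical : ∀ x → ⟦ x ⟧ ≡ integral x
⟦⟧-canonical (+ n)    = ℚP.normalize-coprime (coprime-sym (1-coprimeTo n))
⟦⟧-canonical -[1+ n ] = cong -_ (ℚP.normalize-coprime (coprime-sym (1-coprimeTo (ℕ.suc n))))

⟦⟧-homo-+ : ∀ x y → ⟦ x ℤ.+ y ⟧ ≡ ⟦ x ⟧ + ⟦ y ⟧
⟦⟧-homo-+ x y rewrite ⟦⟧-canonical x | ⟦⟧-canonical y | ⟦⟧-canonical (x ℤ.+ y) =
  ℚP.toℚᵘ-injective (ℚᵘP.≃-trans (ℚᵘ.*≡* cross) (ℚᵘP.≃-sym (ℚP.toℚᵘ-homo-+ (integral x) (integral y))))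
  where
  open ℤSolver.+-*-Solver
  cross : (x ℤ.+ y) ℤ.* + 1 ≡ (x ℤ.* + 1 ℤ.+ y ℤ.* + 1) ℤ.* + 1
  cross = solve 2 (λ x y → (x :+ y) :* con (+ 1) := (x :* con (+ 1) :+ y :* con (+ 1)) :* con (+ 1)) refl x y

⟦⟧-homo‿- : ∀ x → ⟦ ℤ.- x ⟧ ≡ - ⟦ x ⟧
⟦⟧-homo‿- x rewrite ⟦⟧-canonical x | ⟦⟧-canonical (ℤ.- x) =
  ℚP.toℚᵘ-injective (ℚᵘP.≃-trans (ℚᵘ.*≡* refl) (ℚᵘP.≃-sym (ℚP.toℚᵘ-homo‿- (integral x))))

⟦⟧-homo-− : ∀ x y → ⟦ x ℤ.- y ⟧ ≡ ⟦ x ⟧ - ⟦ y ⟧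
⟦⟧-homo-− x y = trans (⟦⟧-homo-+ x (ℤ.- y)) (cong (λ q → ⟦ x ⟧ + q) (⟦⟧-homo‿- y))

⟦⟧-mono-≤ : ∀ {x y} → x ℤ.≤ y → ⟦ x ⟧ ℚ.≤ ⟦ y ⟧
⟦⟧-mono-≤ {x} {y} x≤y rewrite ⟦⟧-canonical x | ⟦⟧-canonical y =
  ℚ.*≤* (subst₂ ℤ._≤_ (≡.sym (ℤP.*-identityʳ x)) (≡.sym (ℤP.*-identityʳ y)) x≤y)

⟦⟧-cancel-≤ : ∀ {x y} → ⟦ x ⟧ ℚ.≤ ⟦ y ⟧ → x ℤ.≤ y
⟦⟧-cancel-≤ {x} {y} ⟦x⟧≤⟦y⟧ rewrite ⟦⟧-canonical x | ⟦⟧-canonical y =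
  subst₂ ℤ._≤_ (ℤP.*-identityʳ x) (ℤP.*-identityʳ y) (ℚP.drop-*≤* ⟦x⟧≤⟦y⟧)

⟦⟧-mono-≤-differences : ∀ w x y z {n} → (w ℤ.- x) ℤ.+ (y ℤ.- z) ℤ.≤ n →
  (⟦ w ⟧ - ⟦ x ⟧) + (⟦ y ⟧ - ⟦ z ⟧) ℚ.≤ ⟦ n ⟧
⟦⟧-mono-≤-differences w x y z sum≤n =
  subst (ℚ._≤ _) (trans (⟦⟧-homo-+ (w ℤ.- x) (y ℤ.- z)) (cong₂ _+_ (⟦⟧-homo-− w x) (⟦⟧-homo-− y z)))
    (⟦⟧-mono-≤ sum≤n)

i≤+∣i∣ : ∀ i → i ℤ.≤ + ∣ i ∣
i≤+∣i∣ (+ n)    = ℤP.≤-refl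
i≤+∣i∣ -[1+ n ] = ℤ.-≤+

∣x-x∣≡0 : ∀ x → ∣ x ℤ.- x ∣ ≡ 0
∣x-x∣≡0 x = cong ∣_∣ (ℤP.+-inverseʳ x)

∣x-z∣≤∣x-y∣+∣y-z∣ : ∀ x y z → ∣ x ℤ.- z ∣ ≤ ∣ x ℤ.- y ∣ ℕ.+ ∣ y ℤ.- z ∣
∣x-z∣≤∣x-y∣+∣y-z∣ x y z = subst (λ d → ∣ d ∣ ≤ ∣ x ℤ.- y ∣ ℕ.+ ∣ y ℤ.- z ∣) telescope
  (ℤP.∣i+j∣≤∣i∣+∣j∣ (x ℤ.- y) (y ℤ.- z))
  where
  open ℤSolver.+-*-Solver
  telescope : (x ℤ.- y) ℤ.+ (y ℤ.- z) ≡ x ℤ.- z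
  telescope = solve 3 (λ x y z → (x :- y) :+ (y :- z) := x :- z) refl x y z

distance≤weight : ∀ {G x z} (p : Path G x z) → ∣ x ℤ.- z ∣ ≤ weight p
distance≤weight {x = x} [] = ℕP.≤-reflexive (∣x-x∣≡0 x)
distance≤weight {x = x} {z} (_∷_ {y = y} _ p) =
  ℕP.≤-trans (∣x-z∣≤∣x-y∣+∣y-z∣ x y z) (ℕP.+-monoʳ-≤ ∣ x ℤ.- y ∣ (distance≤weight p))

vertices-detour≤weight : ∀ {G x z} (p : Path G x z) →
  All (λ v → ∣ x ℤ.- v ∣ ℕ.+ ∣ v ℤ.- z ∣ ≤ weight p) (vertices p)
vertices-detour≤weight {x = x} [] = ℕP.≤-reflexive (cong₂ ℕ._+_ (∣x-x∣≡0 x) (∣x-x∣≡0 x)) ∷ []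
vertices-detour≤weight {x = x} {z} e∷p@(_∷_ {y = y} _ p) =
  subst (_≤ weight e∷p) (cong (ℕ._+ ∣ x ℤ.- z ∣) (≡.sym (∣x-x∣≡0 x))) (distance≤weight e∷p)
  ∷ All.map via-y (vertices-detour≤weight p)
  where
  open ℕP.≤-Reasoning
  via-y : ∀ {v} → ∣ y ℤ.- v ∣ ℕ.+ ∣ v ℤ.- z ∣ ≤ weight p →
          ∣ x ℤ.- v ∣ ℕ.+ ∣ v ℤ.- z ∣ ≤ ∣ x ℤ.- y ∣ ℕ.+ weight p
  via-y {v} detour = begin
    ∣ x ℤ.- v ∣ ℕ.+ ∣ v ℤ.- z ∣                     ≤⟨ ℕP.+-monoˡ-≤ _ (∣x-z∣≤∣x-y∣+∣y-z∣ x y v) ⟩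
    ∣ x ℤ.- y ∣ ℕ.+ ∣ y ℤ.- v ∣ ℕ.+ ∣ v ℤ.- z ∣     ≡⟨ ℕP.+-assoc ∣ x ℤ.- y ∣ _ _ ⟩
    ∣ x ℤ.- y ∣ ℕ.+ (∣ y ℤ.- v ∣ ℕ.+ ∣ v ℤ.- z ∣)   ≤⟨ ℕP.+-monoʳ-≤ ∣ x ℤ.- y ∣ detour ⟩
    ∣ x ℤ.- y ∣ ℕ.+ weight p                         ∎

detour⇒sums≤ : ∀ a b v W → ∣ a ℤ.- v ∣ ℕ.+ ∣ v ℤ.- b ∣ ≤ W →
  (a ℤ.- v) ℤ.+ (b ℤ.- v) ℤ.≤ + W × (v ℤ.- a) ℤ.+ (v ℤ.- b) ℤ.≤ + W
detour⇒sums≤ a b v W detour =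
    ℤP.≤-trans (ℤP.+-mono-≤ (i≤+∣i∣ (a ℤ.- v)) (x-y≤∣y-x∣ b v)) W-bound
  , ℤP.≤-trans (ℤP.+-mono-≤ (x-y≤∣y-x∣ v a) (i≤+∣i∣ (v ℤ.- b))) W-bound
  where
  W-bound : + ∣ a ℤ.- v ∣ ℤ.+ + ∣ v ℤ.- b ∣ ℤ.≤ + W
  W-bound = ℤ.+≤+ detour
  x-y≤∣y-x∣ : ∀ x y → x ℤ.- y ℤ.≤ + ∣ y ℤ.- x ∣
  x-y≤∣y-x∣ x y = subst (λ n → x ℤ.- y ℤ.≤ + n) (ℤP.∣i-j∣≡∣j-i∣ x y) (i≤+∣i∣ (x ℤ.- y))

-- With c = 1/(1+ε), inner ε c L R is the point i of the statement for the
-- endpoints L ≤ R, and inner ε c R L is the point j.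
inner : ℚ → ℚ → ℚ → ℚ → ℚ
inner ε c L R = (1ℚ + ε * ½) * c * L + ε * ½ * c * R

-- (2+ε)x − εy: twice the point obtained by moving x away from y by ε/2 of their distance.
push : ℚ → ℚ → ℚ → ℚ
push ε x y = x + x + ε * (x - y)

push-inner : ∀ {ε c} L R → c * (1ℚ + ε) ≡ 1ℚ → push ε (inner ε c L R) (inner ε c R L) ≡ L + L
push-inner {ε} {c} L R c*[1+ε]≡1 = begin
  push ε (inner ε c L R) (inner ε c R L) ≡⟨ expand ⟩
  (L + L) * (c * (1ℚ + ε))               ≡⟨ cong ((L + L) *_) c*[1+ε]≡1 ⟩
  (L + L) * 1ℚ                           ≡⟨ ℚP.*-identityʳ (L + L) ⟩
  L + L                                  ∎
  where
  open ≡-Reasoning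
  open ℚSolver.+-*-Solver
  expand : push ε (inner ε c L R) (inner ε c R L) ≡ (L + L) * (c * (1ℚ + ε))
  expand = solve 4 (λ ε c L R →
      let i = (con 1ℚ :+ ε :* con ½) :* c :* L :+ ε :* con ½ :* c :* R
          j = (con 1ℚ :+ ε :* con ½) :* c :* R :+ ε :* con ½ :* c :* L
      in  i :+ i :+ ε :* (i :- j) := (L :+ L) :* (c :* (con 1ℚ :+ ε)))
    refl ε c L R

push-mono-≤ : ∀ {ε x x′ y y′} → 0ℚ ℚ.≤ ε → x ℚ.≤ x′ → y′ ℚ.≤ y → push ε x y ℚ.≤ push ε x′ y′
push-mono-≤ {ε} 0≤ε x≤x′ y′≤y =
  ℚP.+-mono-≤ (ℚP.+-mono-≤ x≤x′ x≤x′)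
    (ℚP.*-monoˡ-≤-nonNeg ε {{ℚ.nonNegative 0≤ε}} (ℚP.+-mono-≤ x≤x′ (ℚP.neg-antimono-≤ y′≤y)))

p+p≤q+q⇒p≤q : ∀ {p q} → p + p ℚ.≤ q + q → p ℚ.≤ q
p+p≤q+q⇒p≤q p+p≤q+q = ℚP.≮⇒≥ λ q<p →
  ℚP.<-irrefl refl (ℚP.≤-<-trans p+p≤q+q (ℚP.+-mono-< q<p q<p))

module _ {ε c L R A B V W : ℚ} (0≤ε : 0ℚ ℚ.≤ ε) (c*[1+ε]≡1 : c * (1ℚ + ε) ≡ 1ℚ)
         (i≤A : inner ε c L R ℚ.≤ A) (B≤j : B ℚ.≤ inner ε c R L)
         (W≤[1+ε][B-A] : W ℚ.≤ (1ℚ + ε) * (B - A)) where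
  open ℚP.≤-Reasoning
  open ℚSolver.+-*-Solver

  detour⇒L≤V : (A - V) + (B - V) ℚ.≤ W → L ℚ.≤ V
  detour⇒L≤V detour≤W = p+p≤q+q⇒p≤q (begin
    L + L                                 ≡⟨ push-inner {ε} {c} L R c*[1+ε]≡1 ⟨
    push ε (inner ε c L R) (inner ε c R L) ≤⟨ push-mono-≤ 0≤ε i≤A B≤j ⟩
    push ε A B                            ≡⟨ solve 3 (λ ε A B → A :+ A :+ ε :* (A :- B)
                                               := (A :+ B) :- (con 1ℚ :+ ε) :* (B :- A)) refl ε A B ⟩
    (A + B) - (1ℚ + ε) * (B - A)          ≤⟨ ℚP.+-monoʳ-≤ (A + B) (ℚP.neg-antimono-≤ W≤[1+ε][B-A]) ⟩
    (A + B) - W                           ≤⟨ ℚP.+-monoʳ-≤ (A + B) (ℚP.neg-antimono-≤ detour≤W) ⟩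
    (A + B) - ((A - V) + (B - V))         ≡⟨ solve 3 (λ A B V → (A :+ B) :- ((A :- V) :+ (B :- V))
                                               := V :+ V) refl A B V ⟩
    V + V                                 ∎)

  detour⇒V≤R : (V - A) + (V - B) ℚ.≤ W → V ℚ.≤ R
  detour⇒V≤R detour≤W = p+p≤q+q⇒p≤q (begin
    V + V                                 ≡⟨ solve 3 (λ A B V → V :+ V
                                               := (A :+ B) :+ ((V :- A) :+ (V :- B))) refl A B V ⟩
    (A + B) + ((V - A) + (V - B))         ≤⟨ ℚP.+-monoʳ-≤ (A + B) detour≤W ⟩
    (A + B) + W                           ≤⟨ ℚP.+-monoʳ-≤ (A + B) W≤[1+ε][B-A] ⟩
    (A + B) + (1ℚ + ε) * (B - A)          ≡⟨ solve 3 (λ ε A B → (A :+ B) :+ (con 1ℚ :+ ε) :* (B :- A)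
                                               := B :+ B :+ ε :* (B :- A)) refl ε A B ⟩
    push ε B A                            ≤⟨ push-mono-≤ 0≤ε B≤j i≤A ⟩
    push ε (inner ε c R L) (inner ε c L R) ≡⟨ push-inner {ε} {c} R L c*[1+ε]≡1 ⟩
    R + R                                 ∎)

lemma4p2 : (ε : ℚ) (0≤ε : 0ℚ ℚ.≤ ε) → ε ℚ.≤ 1ℚ →
    (l r : ℕ) → l ≤ r →
    (a b : ℤ) → iPt ε 0≤ε l r ℚ.≤ ⟦ a ⟧ → a ℤ.< b → ⟦ b ⟧ ℚ.≤ jPt ε 0≤ε l r →
    (G : Graph) (P : Path G a b) →
    ⟦ + weight P ⟧ ℚ.≤ (1ℚ ℚ.+ ε) ℚ.* ⟦ b ℤ.- a ⟧ →
    All (λ v → (+ l ℤ.≤ v) × (v ℤ.≤ + r)) (vertices P)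
lemma4p2 ε 0≤ε _ l r _ a b i≤a _ b≤j _ P w≤ = All.map within (vertices-detour≤weight P)
  where
  instance
    1+ε≢0 : ℚ.NonZero (1ℚ + ε)
    1+ε≢0 = 1+ε-nonZero ε 0≤ε
  c : ℚ
  c = ℚ.1/ (1ℚ + ε)
  c*[1+ε]≡1 : c * (1ℚ + ε) ≡ 1ℚ
  c*[1+ε]≡1 = ℚP.*-inverseˡ (1ℚ + ε)
  b≤j′ : ⟦ b ⟧ ℚ.≤ inner ε c ⟦ + r ⟧ ⟦ + l ⟧
  b≤j′ = subst (⟦ b ⟧ ℚ.≤_) (ℚP.+-comm (ε * ½ * c * ⟦ + l ⟧) ((1ℚ + ε * ½) * c * ⟦ + r ⟧)) b≤j
  w≤′ : ⟦ + weight P ⟧ ℚ.≤ (1ℚ + ε) * (⟦ b ⟧ - ⟦ a ⟧)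
  w≤′ = subst (λ d → ⟦ + weight P ⟧ ℚ.≤ (1ℚ + ε) * d) (⟦⟧-homo-− b a) w≤
  within : ∀ {v} → ∣ a ℤ.- v ∣ ℕ.+ ∣ v ℤ.- b ∣ ≤ weight P → (+ l ℤ.≤ v) × (v ℤ.≤ + r)
  within {v} detour =
    let below , above = detour⇒sums≤ a b v (weight P) detour in
      ⟦⟧-cancel-≤ (detour⇒L≤V {V = ⟦ v ⟧} 0≤ε c*[1+ε]≡1 i≤a b≤j′ w≤′ (⟦⟧-mono-≤-differences a v b v below))
    , ⟦⟧-cancel-≤ (detour⇒V≤R {V = ⟦ v ⟧} 0≤ε c*[1+ε]≡1 i≤a b≤j′ w≤′ (⟦⟧-mono-≤-differences v a v b above))
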